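{- Let $P$ be a disjunctive definite program and $I,T$ disjoint sets of ground user-defined atoms. Then $\langle I,T\rangle$ is a model of $P$ if and only if $\langle \emptyset, I\cup T\rangle$ is a model of $P$.
   Context: A disjunctive definite program $P$ consists of one clause per user-defined predicate $p$, of the form $p(V_1,\dots,V_n)\leftarrow (B_1\vee\dots\vee B_k)$, where $V_1,\dots,V_n$ are distinct variables (head variables) and each disjunct $B_j$ is a conjunction consisting of equality atoms $V_1=T_1,\dots,V_n=T_n$ ($T_i$ terms) followed by user-defined atoms; other variables are local variables. Ground atoms are over the Herbrand universe of the program. An interpretation maps each ground user-defined atom to one of $\mathbf{T}$ (true), $\mathbf{F}$ (false), $\mathbf{I}$ (inadmissible); a ground equality atom $s=t$ is $\mathbf{T}$ if $s$ and $t$ are syntactically identical and $\mathbf{F}$ otherwise. For disjoint sets $I,T$ of ground user-defined atoms, $\langle I,T\rangle$ denotes the interpretation mapping atoms of $I$ to $\mathbf{I}$, atoms of $T$ to $\mathbf{T}$, all other ground user-defined atoms to $\mathbf{F}$. Conjunction and disjunction use Kleene's strong three-valued logic: $\wedge$ is $\mathbf{F}$ if some argument is $\mathbf{F}$, else $\mathbf{I}$ if some argument is $\mathbf{I}$, else $\mathbf{T}$; $\vee$ is $\mathbf{T}$ if some argument is $\mathbf{T}$, else $\mathbf{I}$ if some argument is $\mathbf{I}$, else $\mathbf{F}$. An interpretation is a model of $P$ if there is no ground instance $H\leftarrow B$ of a clause of $P$ with $H$ equal to $\mathbf{F}$ and $B$ equal to $\mathbf{T}$ or $\mathbf{I}$.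 -}

module Defs where

open import Data.Nat using (ℕ; zero; suc)
open import Data.Bool using (Bool; true; false; if_then_else_; _∨_)
open import Data.Vec using (Vec; []; _∷_; lookup)
open import Data.List using (List; []; _∷_)
open import Data.Product using (Σ; _×_; _,_)
open import Data.Sum using (_⊎_)
open import Data.Empty using (⊥)
open import Data.Fin using (Fin)
open import Function.Definitions using (Injective)
open import Relation.Nullary using (¬_; Dec; yes; no)
open import Relation.Binary.PropositionalEquality using (_≡_; refl)
open import Relation.Binary.Definitions using (DecidableEquality)

-- First-order signature of a program: function symbols (with arities,
-- decidable equality so that syntactic identity of ground terms can be
-- evaluated) and user-defined predicate symbols (with arities).

record Signature : Set₁ where
  field
    Fun    : Set
    funAr  : Fun → ℕ
    _≟F_   : DecidableEquality Fun
    Pred   : Set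
    predAr : Pred → ℕ

Var : Set
Var = ℕ

-- Three truth values (Kleene): T (true), F (false), I (inadmissible).
data TV : Set where
  𝐓 𝐅 𝐈 : TV

_∧K_ : TV → TV → TV
𝐅 ∧K _ = 𝐅
_ ∧K 𝐅 = 𝐅
𝐈 ∧K _ = 𝐈
_ ∧K 𝐈 = 𝐈
𝐓 ∧K 𝐓 = 𝐓

_∨K_ : TV → TV → TV
𝐓 ∨K _ = 𝐓
_ ∨K 𝐓 = 𝐓
𝐈 ∨K _ = 𝐈
_ ∨K 𝐈 = 𝐈
𝐅 ∨K 𝐅 = 𝐅

⋀ : List TV → TV
⋀ []       = 𝐓
⋀ (v ∷ vs) = v ∧K ⋀ vs

⋁ : List TV → TV
⋁ []       = 𝐅
⋁ (v ∷ vs) = v ∨K ⋁ vs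

module _ (S : Signature) where
  open Signature S

  data Term : Set where
    var : Var → Term
    fn  : (f : Fun) → Vec Term (funAr f) → Term

  data GTerm : Set where
    gfn : (f : Fun) → Vec GTerm (funAr f) → GTerm

  mutual
    _≟G_ : DecidableEquality GTerm
    gfn f xs ≟G gfn g ys with f ≟F g
    ... | no f≢g = no λ { refl → f≢g refl }
    ... | yes refl with ≟Gs xs ys
    ...   | yes refl = yes refl
    ...   | no xs≢ys = no λ { refl → xs≢ys refl }

    ≟Gs : ∀ {n} → DecidableEquality (Vec GTerm n)
    ≟Gs [] [] = yes refl
    ≟Gs (x ∷ xs) (y ∷ ys) with x ≟G y
    ... | no x≢y = no λ { refl → x≢y refl }
    ... | yes refl with ≟Gs xs ys
    ...   | yes refl = yes refl
    ...   | no xs≢ys = no λ { refl → xs≢ys refl }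

  Subst : Set
  Subst = Var → GTerm

  mutual
    _⟨_⟩ : Term → Subst → GTerm
    var x    ⟨ θ ⟩ = θ x
    fn f ts  ⟨ θ ⟩ = gfn f (ts ⟨ θ ⟩s)

    _⟨_⟩s : ∀ {n} → Vec Term n → Subst → Vec GTerm n
    []       ⟨ θ ⟩s = []
    (t ∷ ts) ⟨ θ ⟩s = (t ⟨ θ ⟩) ∷ (ts ⟨ θ ⟩s)

  record Atom : Set where
    constructor atom
    field
      pred : Pred
      args : Vec Term (predAr pred)

  record GAtom : Set where
    constructor gatom
    field
      pred : Pred
      args : Vec GTerm (predAr pred)

  groundAtom : Atom → Subst → GAtom
  groundAtom (atom p ts) θ = gatom p (ts ⟨ θ ⟩s)

  -- A disjunct of the body of a clause with n head variables V₁..Vₙ: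
  -- equality atoms V₁ = T₁, …, Vₙ = Tₙ followed by user-defined atoms.
  record Disjunct (n : ℕ) : Set where
    field
      eqTerms : Vec Term n
      atoms   : List Atom

  record Clause (n : ℕ) : Set where
    field
      headVars : Vec Var n
      distinct : Injective _≡_ _≡_ (lookup headVars)
      body     : List (Disjunct n)

  Program : Set
  Program = (p : Pred) → Clause (predAr p)

  Interpretation : Set
  Interpretation = GAtom → TV

  AtomSet : Set
  AtomSet = GAtom → Bool

  ∅ : AtomSet
  ∅ _ = false

  _∪_ : AtomSet → AtomSet → AtomSet
  (A ∪ B) a = A a ∨ B a

  Disjoint : AtomSet → AtomSet → Set
  Disjoint A B = ∀ a → A a ≡ true → B a ≡ false

  ⟨_,_⟩ : AtomSet → AtomSet → Interpretation
  ⟨ I , T ⟩ a = if I a then 𝐈 else (if T a then 𝐓 else 𝐅)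

  eqVal : GTerm → GTerm → TV
  eqVal s t with s ≟G t
  ... | yes _ = 𝐓
  ... | no  _ = 𝐅

  eqVals : ∀ {n} → Vec Var n → Vec Term n → Subst → List TV
  eqVals []       []       θ = []
  eqVals (v ∷ vs) (t ∷ ts) θ = eqVal (θ v) (t ⟨ θ ⟩) ∷ eqVals vs ts θ

  atomVals : Interpretation → List Atom → Subst → List TV
  atomVals J []       θ = []
  atomVals J (a ∷ as) θ = J (groundAtom a θ) ∷ atomVals J as θ

  appendTV : List TV → List TV → List TV
  appendTV []       ys = ys
  appendTV (x ∷ xs) ys = x ∷ appendTV xs ys

  disjunctVal : ∀ {n} → Interpretation → Vec Var n → Disjunct n → Subst → TV
  disjunctVal J hv d θ =
    ⋀ (appendTV (eqVals hv (Disjunct.eqTerms d) θ) (atomVals J (Disjunct.atoms d) θ))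

  disjunctVals : ∀ {n} → Interpretation → Vec Var n → List (Disjunct n) → Subst → List TV
  disjunctVals J hv []       θ = []
  disjunctVals J hv (d ∷ ds) θ = disjunctVal J hv d θ ∷ disjunctVals J hv ds θ

  bodyVal : Program → Interpretation → (p : Pred) → Subst → TV
  bodyVal P J p θ = ⋁ (disjunctVals J (Clause.headVars (P p)) (Clause.body (P p)) θ)

  headAtom : Program → (p : Pred) → Subst → GAtom
  headAtom P p θ = gatom p (Data.Vec.map θ (Clause.headVars (P p)))

  -- J is a model of P: no ground instance H ← B with H = F and B ∈ {T, I}.
  -- (Every ground instance arises from some p and ground substitution θ.)
  IsModel : Program → Interpretation → Set
  IsModel P J = ∀ (p : Pred) (θ : Subst) →
    ¬ (J (headAtom P p θ) ≡ 𝐅 × (bodyVal P J p θ ≡ 𝐓 ⊎ bodyVal P J p θ ≡ 𝐈))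

{-# OPTIONS --safe #-}
-- Collapsing 𝐈 to 𝐓 is a homomorphism of Kleene's connectives that fixes the
-- two-valued equality atoms, so it commutes with evaluating clause bodies.
-- It also preserves "equals 𝐅" and "equals 𝐓 or 𝐈", which is all the model
-- condition looks at; and ⟨ ∅ , I ∪ T ⟩ is exactly the collapse of ⟨ I , T ⟩.
module Submission where

open import Defs
open import Function.Base using (_∘′_)
open import Function.Bundles using (_⇔_; mk⇔; Equivalence)
open import Data.Bool using (true; false)
open import Data.List using ([]; _∷_; map)
open import Data.Vec using (Vec; []; _∷_)
open import Data.Product using (_×_; _,_)
open import Data.Sum using (_⊎_; inj₁; inj₂)
open import Relation.Nullary using (yes; no)
open import Relation.Binary.PropositionalEquality
  using (_≡_; refl; sym; cong; cong₂; subst₂; _≗_; module ≡-Reasoning)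

collapse : TV → TV
collapse 𝐓 = 𝐓
collapse 𝐅 = 𝐅
collapse 𝐈 = 𝐓

collapse-∧K : ∀ x y → collapse (x ∧K y) ≡ collapse x ∧K collapse y
collapse-∧K 𝐓 𝐓 = refl
collapse-∧K 𝐓 𝐅 = refl
collapse-∧K 𝐓 𝐈 = refl
collapse-∧K 𝐅 y = refl
collapse-∧K 𝐈 𝐓 = refl
collapse-∧K 𝐈 𝐅 = refl
collapse-∧K 𝐈 𝐈 = refl

collapse-∨K : ∀ x y → collapse (x ∨K y) ≡ collapse x ∨K collapse y
collapse-∨K 𝐓 y = refl
collapse-∨K 𝐅 𝐓 = refl
collapse-∨K 𝐅 𝐅 = refl
collapse-∨K 𝐅 𝐈 = refl
collapse-∨K 𝐈 𝐓 = refl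
collapse-∨K 𝐈 𝐅 = refl
collapse-∨K 𝐈 𝐈 = refl

collapse-⋀ : ∀ xs → collapse (⋀ xs) ≡ ⋀ (map collapse xs)
collapse-⋀ []       = refl
collapse-⋀ (x ∷ xs) = begin
  collapse (x ∧K ⋀ xs)             ≡⟨ collapse-∧K x (⋀ xs) ⟩
  collapse x ∧K collapse (⋀ xs)    ≡⟨ cong (collapse x ∧K_) (collapse-⋀ xs) ⟩
  collapse x ∧K ⋀ (map collapse xs) ∎
  where open ≡-Reasoning

collapse-⋁ : ∀ xs → collapse (⋁ xs) ≡ ⋁ (map collapse xs)
collapse-⋁ []       = refl
collapse-⋁ (x ∷ xs) = begin
  collapse (x ∨K ⋁ xs)             ≡⟨ collapse-∨K x (⋁ xs) ⟩
  collapse x ∨K collapse (⋁ xs)    ≡⟨ cong (collapse x ∨K_) (collapse-⋁ xs) ⟩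
  collapse x ∨K ⋁ (map collapse xs) ∎
  where open ≡-Reasoning

Violation : TV → TV → Set
Violation h b = h ≡ 𝐅 × (b ≡ 𝐓 ⊎ b ≡ 𝐈)

collapse-≡𝐅 : ∀ x → collapse x ≡ 𝐅 → x ≡ 𝐅
collapse-≡𝐅 𝐅 _ = refl

collapse-𝐓⊎𝐈 : ∀ x → (collapse x ≡ 𝐓 ⊎ collapse x ≡ 𝐈) ⇔ (x ≡ 𝐓 ⊎ x ≡ 𝐈)
collapse-𝐓⊎𝐈 𝐓 = mk⇔ (λ _ → inj₁ refl) (λ _ → inj₁ refl)
collapse-𝐓⊎𝐈 𝐈 = mk⇔ (λ _ → inj₂ refl) (λ _ → inj₁ refl)
collapse-𝐓⊎𝐈 𝐅 = mk⇔ (λ { (inj₁ ()) ; (inj₂ ()) }) (λ { (inj₁ ()) ; (inj₂ ()) })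

collapse-Violation : ∀ h b → Violation (collapse h) (collapse b) ⇔ Violation h b
collapse-Violation h b = mk⇔
  (λ (h≡𝐅 , b𝐓⊎𝐈) → collapse-≡𝐅 h h≡𝐅 , Equivalence.to (collapse-𝐓⊎𝐈 b) b𝐓⊎𝐈)
  (λ (h≡𝐅 , b𝐓⊎𝐈) → cong collapse h≡𝐅 , Equivalence.from (collapse-𝐓⊎𝐈 b) b𝐓⊎𝐈)

module _ (S : Signature) where

  map-collapse-appendTV : ∀ xs ys →
    map collapse (appendTV S xs ys) ≡ appendTV S (map collapse xs) (map collapse ys)
  map-collapse-appendTV []       ys = refl
  map-collapse-appendTV (x ∷ xs) ys = cong (collapse x ∷_) (map-collapse-appendTV xs ys)

  collapse-eqVal : ∀ s t → collapse (eqVal S s t) ≡ eqVal S s t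
  collapse-eqVal s t with _≟G_ S s t
  ... | yes _ = refl
  ... | no  _ = refl

  map-collapse-eqVals : ∀ {n} (hv : Vec Var n) ts θ →
    map collapse (eqVals S hv ts θ) ≡ eqVals S hv ts θ
  map-collapse-eqVals []       []       θ = refl
  map-collapse-eqVals (v ∷ hv) (t ∷ ts) θ =
    cong₂ _∷_ (collapse-eqVal (θ v) (_⟨_⟩ S t θ)) (map-collapse-eqVals hv ts θ)

  module _ {J J′ : Interpretation S} (J′≗ : J′ ≗ collapse ∘′ J) where

    atomVals-collapse : ∀ as θ → atomVals S J′ as θ ≡ map collapse (atomVals S J as θ)
    atomVals-collapse []       θ = refl
    atomVals-collapse (a ∷ as) θ = cong₂ _∷_ (J′≗ (groundAtom S a θ)) (atomVals-collapse as θ)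

    disjunctVal-collapse : ∀ {n} (hv : Vec Var n) d θ →
      disjunctVal S J′ hv d θ ≡ collapse (disjunctVal S J hv d θ)
    disjunctVal-collapse hv d θ = begin
      ⋀ (appendTV S es (atomVals S J′ as θ))
        ≡⟨ cong (λ vs → ⋀ (appendTV S vs (atomVals S J′ as θ))) (sym (map-collapse-eqVals hv ts θ)) ⟩
      ⋀ (appendTV S (map collapse es) (atomVals S J′ as θ))
        ≡⟨ cong (λ vs → ⋀ (appendTV S (map collapse es) vs)) (atomVals-collapse as θ) ⟩
      ⋀ (appendTV S (map collapse es) (map collapse (atomVals S J as θ)))
        ≡⟨ cong ⋀ (sym (map-collapse-appendTV es (atomVals S J as θ))) ⟩
      ⋀ (map collapse (appendTV S es (atomVals S J as θ)))
        ≡⟨ sym (collapse-⋀ (appendTV S es (atomVals S J as θ))) ⟩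
      collapse (⋀ (appendTV S es (atomVals S J as θ))) ∎
      where
        open ≡-Reasoning
        ts = Disjunct.eqTerms d
        as = Disjunct.atoms d
        es = eqVals S hv ts θ

    disjunctVals-collapse : ∀ {n} (hv : Vec Var n) ds θ →
      disjunctVals S J′ hv ds θ ≡ map collapse (disjunctVals S J hv ds θ)
    disjunctVals-collapse hv []       θ = refl
    disjunctVals-collapse hv (d ∷ ds) θ =
      cong₂ _∷_ (disjunctVal-collapse hv d θ) (disjunctVals-collapse hv ds θ)

    bodyVal-collapse : ∀ P p θ → bodyVal S P J′ p θ ≡ collapse (bodyVal S P J p θ)
    bodyVal-collapse P p θ = begin
      ⋁ (disjunctVals S J′ hv ds θ)              ≡⟨ cong ⋁ (disjunctVals-collapse hv ds θ) ⟩
      ⋁ (map collapse (disjunctVals S J hv ds θ)) ≡⟨ sym (collapse-⋁ (disjunctVals S J hv ds θ)) ⟩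
      collapse (⋁ (disjunctVals S J hv ds θ))     ∎
      where
        open ≡-Reasoning
        hv = Clause.headVars (P p)
        ds = Clause.body (P p)

    isModel-collapse : ∀ P → IsModel S P J ⇔ IsModel S P J′
    isModel-collapse P = mk⇔
      (λ M p θ v → M p θ (Equivalence.to (collapse-Violation _ _) (to-collapsed p θ v)))
      (λ M p θ v → M p θ (from-collapsed p θ (Equivalence.from (collapse-Violation _ _) v)))
      where
        to-collapsed : ∀ p θ → Violation (J′ (headAtom S P p θ)) (bodyVal S P J′ p θ) →
          Violation (collapse (J (headAtom S P p θ))) (collapse (bodyVal S P J p θ))
        to-collapsed p θ = subst₂ Violation (J′≗ _) (bodyVal-collapse P p θ)

        from-collapsed : ∀ p θ →
          Violation (collapse (J (headAtom S P p θ))) (collapse (bodyVal S P J p θ)) →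
          Violation (J′ (headAtom S P p θ)) (bodyVal S P J′ p θ)
        from-collapsed p θ = subst₂ Violation (sym (J′≗ _)) (sym (bodyVal-collapse P p θ))

  -- No disjointness is needed here: ⟨ I , T ⟩ gives I precedence over T.
  ⟨∅,∪⟩≗collapse∘⟨,⟩ : ∀ I T → ⟨_,_⟩ S (∅ S) (_∪_ S I T) ≗ collapse ∘′ ⟨_,_⟩ S I T
  ⟨∅,∪⟩≗collapse∘⟨,⟩ I T a with I a | T a
  ... | true  | _     = refl
  ... | false | true  = refl
  ... | false | false = refl

mainTheorem4 : (S : Signature) (P : Program S) (I T : AtomSet S) →
    Disjoint S I T →
    (IsModel S P (⟨_,_⟩ S I T) ⇔ IsModel S P (⟨_,_⟩ S (∅ S) (_∪_ S I T)))
mainTheorem4 S P I T _ = isModel-collapse S (⟨∅,∪⟩≗collapse∘⟨,⟩ S I T) P
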